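{- Let $D$ be a $2$-acyclic multidigraph. Then $\mathrm{DT}(D)=\mathrm{Ind}(G^{\mathbf{t}}_D)$.
   Context: A multidigraph $D$ consists of finite sets $V(D)$, $E(D)$ and maps $s,t:E(D)\to V(D)$ (source, target). A directed cycle is a connected multidigraph without parallel edges in which every vertex has in-degree and out-degree $1$; its length is its number of vertices. $D$ is $2$-acyclic if it contains no directed cycle of length at least $3$. For $\sigma\subseteq E(D)$, $D[\sigma]$ is the multidigraph with edge set $\sigma$ and vertex set the endpoints of edges of $\sigma$. A directed forest is a digraph (no parallel edges) with no directed cycles in which no two distinct edges share the same target. $\mathrm{DT}(D)$ is the simplicial complex on $E(D)$ whose faces are the $\sigma$ with $D[\sigma]$ a directed forest. The tree conflict graph $G^{\mathbf{t}}_D$ is the simple graph with vertex set $E(D)$ in which distinct $e,f$ are adjacent iff $t(e)=t(f)$ or $\{s(e),t(e)\}=\{s(f),t(f)\}$. $\mathrm{Ind}(G)$ is the independence complex of a graph $G$.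
   Formalization: The multidigraph D is also taken to be loopless, so s(e) ≠ t(e) holds for every edge e of D. The statement above fails without it. -}

module Defs where

open import Data.Nat using (ℕ; suc; _≤_)
open import Data.Nat.DivMod using (_%_; m%n<n)
open import Data.Fin using (Fin; toℕ; fromℕ<)
open import Data.Fin.Subset using (Subset; _∈_)
open import Data.Product using (Σ; _×_; ∃)
open import Data.Sum using (_⊎_)
open import Relation.Nullary using (¬_)
open import Relation.Binary.PropositionalEquality using (_≡_; _≢_)
open import Function.Definitions using (Injective)
open import Function.Bundles using (_⇔_)

record Multidigraph : Set where
  field
    nV : ℕ
    nE : ℕ
    s  : Fin nE → Fin nV
    t  : Fin nE → Fin nV
open Multidigraph public

next : {k : ℕ} → Fin (suc k) → Fin (suc k)
next {k} i = fromℕ< (m%n<n (suc (toℕ i)) (suc k))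

-- A directed cycle of length (suc k) in D all of whose edges satisfy P:
-- pairwise distinct vertices v₀,…,v_k and edges eᵢ : vᵢ → v_{i+1 mod (k+1)}.
record DirCycle (D : Multidigraph) (P : Fin (nE D) → Set) (k : ℕ) : Set where
  field
    vs    : Fin (suc k) → Fin (nV D)
    es    : Fin (suc k) → Fin (nE D)
    vsInj : Injective _≡_ _≡_ vs
    src   : ∀ i → s D (es i) ≡ vs i
    tgt   : ∀ i → t D (es i) ≡ vs (next i)
    inP   : ∀ i → P (es i)

-- no loops (a loop would be a directed cycle of length 1)
Loopless : Multidigraph → Set
Loopless D = ∀ e → s D e ≢ t D e

-- 2-acyclic: no directed cycle of length ≥ 3 (edge predicate Fin 1 = always true)
TwoAcyclic : Multidigraph → Set
TwoAcyclic D = ∀ k → 3 ≤ suc k → ¬ DirCycle D (λ _ → Fin 1) k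

IsDirectedForest : (D : Multidigraph) → Subset (nE D) → Set
IsDirectedForest D σ =
  (∀ e f → e ∈ σ → f ∈ σ → e ≢ f → ¬ (s D e ≡ s D f × t D e ≡ t D f)) ×
  (∀ e f → e ∈ σ → f ∈ σ → e ≢ f → t D e ≢ t D f) ×
  (∀ k → ¬ DirCycle D (λ e → e ∈ σ) k)

DT : (D : Multidigraph) → Subset (nE D) → Set
DT D σ = IsDirectedForest D σ

record SimpleGraph (n : ℕ) : Set₁ where
  field
    Adj : Fin n → Fin n → Set
open SimpleGraph public

treeConflict : (D : Multidigraph) → SimpleGraph (nE D)
treeConflict D = record
  { Adj = λ e f → e ≢ f ×
      (t D e ≡ t D f ⊎
       ((s D e ≡ s D f × t D e ≡ t D f) ⊎ (s D e ≡ t D f × t D e ≡ s D f))) }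

Ind : {n : ℕ} → SimpleGraph n → Subset n → Set
Ind G σ = ∀ e f → e ∈ σ → f ∈ σ → ¬ Adj G e f

_≐_ : {n : ℕ} → (Subset n → Set) → (Subset n → Set) → Set
K ≐ L = ∀ σ → K σ ⇔ L σ

{-# OPTIONS --safe #-}
module Submission where

open import Defs
open import Data.Nat using (suc; s≤s; z≤n)
open import Data.Fin using (Fin; zero; suc)
open import Data.Fin.Subset using (_∈_)
open import Data.Product using (_×_; _,_)
open import Data.Sum using (inj₁; inj₂)
open import Data.Empty using (⊥-elim)
open import Relation.Nullary using (¬_)
open import Relation.Binary.PropositionalEquality using (_≡_; _≢_; refl; sym; trans; cong)
open import Function.Bundles using (mk⇔)

-- An edge of G^t_D joins e and f iff they share a target, are parallel, or are
-- antiparallel; the last kind is a directed 2-cycle.  So for a loopless D an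
-- independent set of G^t_D is a directed forest up to cycles of length ≥ 3,
-- which 2-acyclicity rules out.

Antiparallel : (D : Multidigraph) → Fin (nE D) → Fin (nE D) → Set
Antiparallel D e f = s D e ≡ t D f × t D e ≡ s D f

module _ {D : Multidigraph} where

  DirCycle-mono : ∀ {P Q : Fin (nE D) → Set} {k} →
                  (∀ {e} → P e → Q e) → DirCycle D P k → DirCycle D Q k
  DirCycle-mono P⇒Q c = record
    { vs = vs ; es = es ; vsInj = vsInj ; src = src ; tgt = tgt ; inP = λ i → P⇒Q (inP i) }
    where open DirCycle c

  DirCycle₀⇒¬Loopless : ∀ {P} → DirCycle D P 0 → ¬ Loopless D
  DirCycle₀⇒¬Loopless c noLoop = noLoop (es zero) (trans (src zero) (sym (tgt zero)))
    where open DirCycle c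

  antiparallel⇒DirCycle₁ : ∀ {P : Fin (nE D) → Set} {e f} → s D e ≢ t D e →
                           P e → P f → Antiparallel D e f → DirCycle D P 1
  antiparallel⇒DirCycle₁ {P} {e} {f} s≢t pe pf (se≡tf , te≡sf) = record
    { vs = vs ; es = es ; vsInj = vsInj ; src = src ; tgt = tgt ; inP = inP }
    where
    vs : Fin 2 → Fin (nV D)
    vs zero       = s D e
    vs (suc zero) = t D e
    es : Fin 2 → Fin (nE D)
    es zero       = e
    es (suc zero) = f
    vsInj : ∀ {i j} → vs i ≡ vs j → i ≡ j
    vsInj {zero}     {zero}     _ = refl
    vsInj {zero}     {suc zero} q = ⊥-elim (s≢t q)
    vsInj {suc zero} {zero}     q = ⊥-elim (s≢t (sym q))
    vsInj {suc zero} {suc zero} _ = refl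
    src : ∀ i → s D (es i) ≡ vs i
    src zero       = refl
    src (suc zero) = sym te≡sf
    tgt : ∀ i → t D (es i) ≡ vs (next i)
    tgt zero       = refl
    tgt (suc zero) = sym se≡tf
    inP : ∀ i → P (es i)
    inP zero       = pe
    inP (suc zero) = pf

  DirCycle₁⇒antiparallel : ∀ {P} (c : DirCycle D P 1) →
    let open DirCycle c in
    es zero ≢ es (suc zero) × Antiparallel D (es zero) (es (suc zero))
  DirCycle₁⇒antiparallel c =
    distinct , trans (src zero) (sym (tgt (suc zero))) , trans (tgt zero) (sym (src (suc zero)))
    where
    open DirCycle c
    distinct : es zero ≢ es (suc zero)
    distinct q with vsInj (trans (sym (src zero)) (trans (cong (s D) q) (src (suc zero))))
    ... | ()

  DT⊆Ind : Loopless D → ∀ σ → DT D σ → Ind (treeConflict D) σ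
  DT⊆Ind noLoop σ (noParallel , noSharedTarget , noCycle) e f e∈σ f∈σ (e≢f , conflict)
    with conflict
  ... | inj₁ sameTarget        = noSharedTarget e f e∈σ f∈σ e≢f sameTarget
  ... | inj₂ (inj₁ parallel)   = noParallel e f e∈σ f∈σ e≢f parallel
  ... | inj₂ (inj₂ antiparallel) =
    noCycle 1 (antiparallel⇒DirCycle₁ (noLoop e) e∈σ f∈σ antiparallel)

  Ind⊆DT : Loopless D → TwoAcyclic D → ∀ σ → Ind (treeConflict D) σ → DT D σ
  Ind⊆DT noLoop twoAcyclic σ independent = noParallel , noSharedTarget , noCycle
    where
    noParallel : ∀ e f → e ∈ σ → f ∈ σ → e ≢ f → ¬ (s D e ≡ s D f × t D e ≡ t D f)
    noParallel e f e∈σ f∈σ e≢f parallel = independent e f e∈σ f∈σ (e≢f , inj₂ (inj₁ parallel))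
    noSharedTarget : ∀ e f → e ∈ σ → f ∈ σ → e ≢ f → t D e ≢ t D f
    noSharedTarget e f e∈σ f∈σ e≢f sameTarget = independent e f e∈σ f∈σ (e≢f , inj₁ sameTarget)
    noCycle : ∀ k → ¬ DirCycle D (_∈ σ) k
    noCycle 0 c = DirCycle₀⇒¬Loopless c noLoop
    noCycle 1 c with DirCycle₁⇒antiparallel c
    ... | e≢f , antiparallel =
      independent _ _ (inP zero) (inP (suc zero)) (e≢f , inj₂ (inj₂ antiparallel))
      where open DirCycle c
    noCycle (suc (suc k)) c = twoAcyclic (suc (suc k)) (s≤s (s≤s (s≤s z≤n))) (DirCycle-mono (λ _ → zero) c)

lemma4p2 : (D : Multidigraph) → Loopless D → TwoAcyclic D →
    DT D ≐ Ind (treeConflict D)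
lemma4p2 D noLoop twoAcyclic σ = mk⇔ (DT⊆Ind noLoop σ) (Ind⊆DT noLoop twoAcyclic σ)
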